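{- Let $G=([n],E)$ be an interval graph with an interval representation $I_v=[\ell_v,r_v]$, $v\in[n]$, in which all endpoints are distinct and lie in $[2n]$, and $\ell_1<\ell_2<\dots<\ell_n$. For each vertex $v$ let $B_v=\{w:\ell_v\in I_w\}$ and $s_v=\min B_v$. Construct a rooted ordinal tree $T$ on the vertex set $[n]$ with root $1$ by processing $v=2,\dots,n$ in increasing order and attaching $v$ as the new rightmost (last) child of its parent $p(v)$, where $p(v)=s_v$ if $s_v\ne v$, and $p(v)=v-1$ if $s_v=v$ (i.e. $v$ is the leftmost vertex of a connected component). Let $a_1,a_2,\dots,a_n$ be the left-to-right breadth-first (level-order) traversal of $T$. Then $a_i=i$ for all $i\in[n]$.
   Context: An interval graph has vertices corresponding to intervals on the real line, with an edge between two vertices iff their intervals intersect. Note $v\in B_v$, so $s_v\le v$. -}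

module Defs where

open import Data.Nat using (ℕ; zero; suc; _+_; _∸_; _≤_; _<_; _≟_)
open import Data.List using (List; []; _∷_; map; filter; concatMap; upTo)
open import Data.Product using (_×_)
open import Relation.Nullary using (yes; no)

InB : (ℓ r : ℕ → ℕ) → ℕ → ℕ → Set
InB ℓ r v w = ℓ w ≤ ℓ v × ℓ v ≤ r w

InRange : ℕ → ℕ → Set
InRange n w = 1 ≤ w × w ≤ n

IsMinB : (n : ℕ) (ℓ r : ℕ → ℕ) → ℕ → ℕ → Set
IsMinB n ℓ r v m =
  InRange n m × InB ℓ r v m × (∀ w → InRange n w → InB ℓ r v w → m ≤ w)

parent : (s : ℕ → ℕ) → ℕ → ℕ
parent s v with s v ≟ v
... | yes _ = v ∸ 1
... | no  _ = s v

nonRoot : ℕ → List ℕ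
nonRoot n = map (2 +_) (upTo (n ∸ 1))

-- children of u, left to right: since v is appended as the last child when
-- processed in increasing order, the children list is increasing in v
children : (p : ℕ → ℕ) (n : ℕ) → ℕ → List ℕ
children p n u = filter (λ v → p v ≟ u) (nonRoot n)

level : (p : ℕ → ℕ) (n : ℕ) → ℕ → List ℕ
level p n zero = 1 ∷ []
level p n (suc k) = concatMap (children p n) (level p n k)

-- left-to-right breadth-first (level-order) traversal: levels 0,…,n-1
-- (the depth of a tree on n vertices is at most n-1)
levelOrder : (p : ℕ → ℕ) (n : ℕ) → List ℕ
levelOrder p n = concatMap (level p n) (upTo n)

module Submission where

open import Defs
open import Data.Nat using (ℕ; zero; suc; _+_; _∸_; _≤_; _<_; _≟_; _<?_; _≤?_; z≤n; s≤s; s≤s⁻¹)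
open import Data.Nat.Properties
open import Data.List using (List; []; _∷_; _++_; map; filter; concatMap; upTo; applyUpTo; [_])
open import Data.List.Properties
  using (filter-all; filter-none; filter-++; concatMap-++; map-upTo; upTo-∷ʳ; ++-identityʳ)
open import Data.List.Relation.Unary.All using (All; []; _∷_)
open import Data.Product using (_×_; _,_; proj₁; proj₂)
open import Data.Sum using (inj₁; inj₂)
open import Relation.Nullary using (yes; no; ¬_; contradiction)
open import Relation.Binary.PropositionalEquality hiding ([_])

-- Because ℓ is increasing, s_v ≤ v and s is nondecreasing, so the parent map
-- p is nondecreasing with p v < v.  For such a p the vertices with parent u
-- form a contiguous block [cut u, cut (u+1)), where cut u is the first vertex
-- whose parent is at least u.  Concatenating the blocks of a contiguous run
-- of parents [a, b) gives [cut a, cut b), so each level of T is the interval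
-- that starts where the previous level ends, and since cut u > u these
-- intervals exhaust 1, …, n.

rangeFrom : ℕ → ℕ → List ℕ
rangeFrom a zero    = []
rangeFrom a (suc k) = a ∷ rangeFrom (suc a) k

range : ℕ → ℕ → List ℕ
range a b = rangeFrom a (b ∸ a)

All-rangeFrom : ∀ {P : ℕ → Set} a k → (∀ v → a ≤ v → v < a + k → P v) → All P (rangeFrom a k)
All-rangeFrom a zero    h = []
All-rangeFrom a (suc k) h =
  h a ≤-refl (m<m+n a (s≤s z≤n))
  ∷ All-rangeFrom (suc a) k (λ v a<v v<1+a+k → h v (<⇒≤ a<v) (subst (v <_) (sym (+-suc a k)) v<1+a+k))

All-range : ∀ {P : ℕ → Set} {a b} → a ≤ b → (∀ v → a ≤ v → v < b → P v) → All P (range a b)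
All-range {a = a} {b} a≤b h = All-rangeFrom a (b ∸ a) (λ v a≤v v<b → h v a≤v (subst (v <_) (m+[n∸m]≡n a≤b) v<b))

rangeFrom-++ : ∀ a k m → rangeFrom a (k + m) ≡ rangeFrom a k ++ rangeFrom (a + k) m
rangeFrom-++ a zero    m = cong (λ b → rangeFrom b m) (sym (+-identityʳ a))
rangeFrom-++ a (suc k) m =
  cong (a ∷_) (trans (rangeFrom-++ (suc a) k m) (cong (λ b → rangeFrom (suc a) k ++ rangeFrom b m) (sym (+-suc a k))))

range-++ : ∀ {x y z} → x ≤ y → y ≤ z → range x y ++ range y z ≡ range x z
range-++ {x} {y} {z} x≤y y≤z = begin
  rangeFrom x (y ∸ x) ++ rangeFrom y (z ∸ y)         ≡⟨ cong (λ b → rangeFrom x (y ∸ x) ++ rangeFrom b (z ∸ y)) (sym (m+[n∸m]≡n x≤y)) ⟩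
  rangeFrom x (y ∸ x) ++ rangeFrom (x + (y ∸ x)) (z ∸ y) ≡⟨ sym (rangeFrom-++ x (y ∸ x) (z ∸ y)) ⟩
  rangeFrom x ((y ∸ x) + (z ∸ y))                     ≡⟨ cong (rangeFrom x) length-sum ⟩
  rangeFrom x (z ∸ x)                                 ∎
  where
  open ≡-Reasoning
  length-sum : (y ∸ x) + (z ∸ y) ≡ z ∸ x
  length-sum = begin
    (y ∸ x) + (z ∸ y)   ≡⟨ +-comm (y ∸ x) (z ∸ y) ⟩
    (z ∸ y) + (y ∸ x)   ≡⟨ sym (+-∸-assoc (z ∸ y) x≤y) ⟩
    ((z ∸ y) + y) ∸ x   ≡⟨ cong (_∸ x) (m∸n+n≡m y≤z) ⟩
    z ∸ x               ∎

applyUpTo-rangeFrom : ∀ (f : ℕ → ℕ) a k → (∀ i → f i ≡ a + i) → applyUpTo f k ≡ rangeFrom a k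
applyUpTo-rangeFrom f a zero    f≗a+ = refl
applyUpTo-rangeFrom f a (suc k) f≗a+ = cong₂ _∷_ (trans (f≗a+ 0) (+-identityʳ a))
  (applyUpTo-rangeFrom (λ i → f (suc i)) (suc a) k (λ i → trans (f≗a+ (suc i)) (+-suc a i)))

module MonotoneParent (n : ℕ) (1≤n : 1 ≤ n) (p : ℕ → ℕ)
  (p-positive : ∀ v → 2 ≤ v → v ≤ n → 1 ≤ p v)
  (p-decreasing : ∀ v → 2 ≤ v → v ≤ n → p v < v)
  (p-monotone : ∀ v w → 2 ≤ v → v ≤ w → w ≤ n → p v ≤ p w) where

  record IsCut (u y : ℕ) : Set where
    field
      2≤y : 2 ≤ y
      y≤1+n : y ≤ suc n
      parent<u : ∀ v → 2 ≤ v → v < y → p v < u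
      u≤parent : ∀ v → y ≤ v → v ≤ n → u ≤ p v
  open IsCut

  findCut : ℕ → ℕ → ℕ → ℕ
  findCut u x zero = x
  findCut u x (suc f) with p x <? u
  ... | yes _ = findCut u (suc x) f
  ... | no  _ = x

  cut : ℕ → ℕ
  cut u = findCut u 2 (n ∸ 1)

  findCut-isCut : ∀ u x f → x + f ≡ suc n → 2 ≤ x → (∀ v → 2 ≤ v → v < x → p v < u) → IsCut u (findCut u x f)
  findCut-isCut u x zero x≡1+n 2≤x below = record
    { 2≤y = 2≤x
    ; y≤1+n = ≤-reflexive x≡1+n′
    ; parent<u = below
    ; u≤parent = λ v x≤v v≤n → contradiction (≤-trans x≤v v≤n) (<⇒≱ (≤-reflexive (sym x≡1+n′)))
    }
    where x≡1+n′ = trans (sym (+-identityʳ x)) x≡1+n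
  findCut-isCut u x (suc f) x+f≡1+n 2≤x below with p x <? u
  ... | yes px<u = findCut-isCut u (suc x) f (trans (sym (+-suc x f)) x+f≡1+n) (m≤n⇒m≤1+n 2≤x) below′
    where
    below′ : ∀ v → 2 ≤ v → v < suc x → p v < u
    below′ v 2≤v v<1+x with m≤n⇒m<n∨m≡n (s≤s⁻¹ v<1+x)
    ... | inj₁ v<x  = below v 2≤v v<x
    ... | inj₂ refl = px<u
  ... | no px≮u = record
    { 2≤y = 2≤x
    ; y≤1+n = ≤-trans (m≤m+n x (suc f)) (≤-reflexive x+f≡1+n)
    ; parent<u = below
    ; u≤parent = λ v x≤v v≤n → ≤-trans (≮⇒≥ px≮u) (p-monotone x v 2≤x x≤v v≤n)
    }

  cut-isCut : ∀ u → IsCut u (cut u)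
  cut-isCut u = findCut-isCut u 2 (n ∸ 1) (cong suc (m+[n∸m]≡n 1≤n)) ≤-refl
    (λ v 2≤v v<2 → contradiction 2≤v (<⇒≱ v<2))

  isCut-mono : ∀ {u u′ y y′} → u ≤ u′ → IsCut u y → IsCut u′ y′ → y ≤ y′
  isCut-mono {u} {u′} {y} {y′} u≤u′ cy cy′ with y ≤? y′
  ... | yes y≤y′ = y≤y′
  ... | no  y≰y′ = contradiction (≤-trans u≤u′ (u≤parent cy′ y′ ≤-refl y′≤n)) (<⇒≱ (parent<u cy y′ (2≤y cy′) y′<y))
    where
    y′<y = ≰⇒> y≰y′
    y′≤n = s≤s⁻¹ (≤-trans y′<y (y≤1+n cy))

  cut-mono : ∀ {u u′} → u ≤ u′ → cut u ≤ cut u′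
  cut-mono u≤u′ = isCut-mono u≤u′ (cut-isCut _) (cut-isCut _)

  u<cut : ∀ u → u ≤ n → u < cut u
  u<cut u u≤n with cut u ≤? u
  ... | no  cut≰u  = ≰⇒> cut≰u
  ... | yes cut≤u = contradiction (u≤parent (cut-isCut u) u cut≤u u≤n) (<⇒≱ (p-decreasing u 2≤u u≤n))
    where 2≤u = ≤-trans (2≤y (cut-isCut u)) cut≤u

  cut1≡2 : cut 1 ≡ 2
  cut1≡2 with cut 1 ≤? 2
  ... | yes cut≤2 = ≤-antisym cut≤2 (2≤y (cut-isCut 1))
  ... | no  cut≰2 = contradiction (p-positive 2 ≤-refl 2≤n) (<⇒≱ (parent<u (cut-isCut 1) 2 ≤-refl 2<cut))
    where
    2<cut = ≰⇒> cut≰2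
    2≤n = s≤s⁻¹ (≤-trans 2<cut (y≤1+n (cut-isCut 1)))

  nonRoot≡range : nonRoot n ≡ range 2 (suc n)
  nonRoot≡range = trans (map-upTo (2 +_) (n ∸ 1)) (applyUpTo-rangeFrom (2 +_) 2 (n ∸ 1) (λ i → refl))

  children≡range : ∀ u → children p n u ≡ range (cut u) (cut (suc u))
  children≡range u = begin
    filter P? (nonRoot n)                                                             ≡⟨ cong (filter P?) nonRoot≡range ⟩
    filter P? (range 2 (suc n))                                                       ≡⟨ cong (filter P?) (sym split) ⟩
    filter P? (range 2 x ++ range x y ++ range y (suc n))                             ≡⟨ filter-++ P? (range 2 x) _ ⟩
    filter P? (range 2 x) ++ filter P? (range x y ++ range y (suc n))                 ≡⟨ cong (filter P? (range 2 x) ++_) (filter-++ P? (range x y) _) ⟩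
    filter P? (range 2 x) ++ filter P? (range x y) ++ filter P? (range y (suc n))     ≡⟨ cong₂ (λ as bs → as ++ filter P? (range x y) ++ bs) (filter-none P? before) (filter-none P? after) ⟩
    filter P? (range x y) ++ []                                                       ≡⟨ ++-identityʳ _ ⟩
    filter P? (range x y)                                                             ≡⟨ filter-all P? within ⟩
    range x y                                                                         ∎
    where
    open ≡-Reasoning
    P? = λ v → p v ≟ u
    x = cut u
    y = cut (suc u)
    cx = cut-isCut u
    cy = cut-isCut (suc u)
    x≤y : x ≤ y
    x≤y = cut-mono (n≤1+n u)
    split : range 2 x ++ range x y ++ range y (suc n) ≡ range 2 (suc n)
    split = trans (cong (range 2 x ++_) (range-++ x≤y (y≤1+n cy))) (range-++ (2≤y cx) (y≤1+n cx))
    before : All (λ v → ¬ (p v ≡ u)) (range 2 x)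
    before = All-range (2≤y cx) (λ v 2≤v v<x pv≡u → <-irrefl pv≡u (parent<u cx v 2≤v v<x))
    within : All (λ v → p v ≡ u) (range x y)
    within = All-range x≤y (λ v x≤v v<y → ≤-antisym
      (s≤s⁻¹ (parent<u cy v (≤-trans (2≤y cx) x≤v) v<y))
      (u≤parent cx v x≤v (s≤s⁻¹ (≤-trans v<y (y≤1+n cy)))))
    after : All (λ v → ¬ (p v ≡ u)) (range y (suc n))
    after = All-range (y≤1+n cy) (λ v y≤v v≤n pv≡u → <-irrefl (sym pv≡u) (u≤parent cy v y≤v (s≤s⁻¹ v≤n)))

  concatMap-children-rangeFrom : ∀ a k → concatMap (children p n) (rangeFrom a k) ≡ range (cut a) (cut (a + k))
  concatMap-children-rangeFrom a zero = cong (rangeFrom (cut a)) (sym (begin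
    cut (a + 0) ∸ cut a   ≡⟨ cong (λ b → cut b ∸ cut a) (+-identityʳ a) ⟩
    cut a ∸ cut a         ≡⟨ n∸n≡0 (cut a) ⟩
    0                     ∎))
    where open ≡-Reasoning
  concatMap-children-rangeFrom a (suc k) = begin
    children p n a ++ concatMap (children p n) (rangeFrom (suc a) k)   ≡⟨ cong₂ _++_ (children≡range a) (concatMap-children-rangeFrom (suc a) k) ⟩
    range (cut a) (cut (suc a)) ++ range (cut (suc a)) (cut (suc a + k)) ≡⟨ range-++ (cut-mono (n≤1+n a)) (cut-mono (m≤m+n (suc a) k)) ⟩
    range (cut a) (cut (suc a + k))                                    ≡⟨ cong (λ b → range (cut a) (cut b)) (sym (+-suc a k)) ⟩
    range (cut a) (cut (a + suc k))                                    ∎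
    where open ≡-Reasoning

  concatMap-children-range : ∀ {a b} → a ≤ b → concatMap (children p n) (range a b) ≡ range (cut a) (cut b)
  concatMap-children-range {a} {b} a≤b =
    trans (concatMap-children-rangeFrom a (b ∸ a)) (cong (λ c → range (cut a) (cut c)) (m+[n∸m]≡n a≤b))

  levelStart : ℕ → ℕ
  levelStart zero    = 1
  levelStart (suc k) = cut (levelStart k)

  levelStart-≤-suc : ∀ k → levelStart k ≤ levelStart (suc k)
  levelStart-≤-suc zero    = ≤-trans (n≤1+n 1) (2≤y (cut-isCut 1))
  levelStart-≤-suc (suc k) = cut-mono (levelStart-≤-suc k)

  1≤levelStart : ∀ k → 1 ≤ levelStart k
  1≤levelStart zero    = ≤-refl
  1≤levelStart (suc k) = ≤-trans (1≤levelStart k) (levelStart-≤-suc k)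

  levelStart≤1+n : ∀ k → levelStart k ≤ suc n
  levelStart≤1+n zero    = s≤s z≤n
  levelStart≤1+n (suc k) = y≤1+n (cut-isCut (levelStart k))

  level≡range : ∀ k → level p n k ≡ range (levelStart k) (levelStart (suc k))
  level≡range zero    = cong (rangeFrom 1) (cong (_∸ 1) (sym cut1≡2))
  level≡range (suc k) = trans (cong (concatMap (children p n)) (level≡range k))
                              (concatMap-children-range (levelStart-≤-suc k))

  k<levelStart : ∀ k → k ≤ n → k < levelStart k
  k<levelStart zero    _     = ≤-refl
  k<levelStart (suc k) 1+k≤n with levelStart k ≤? n
  ... | yes start≤n = ≤-<-trans (k<levelStart k (<⇒≤ 1+k≤n)) (u<cut (levelStart k) start≤n)
  ... | no  start≰n = ≤-trans (s≤s 1+k≤n) (≤-trans (≰⇒> start≰n) (levelStart-≤-suc k))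

  levelStart-n≡1+n : levelStart n ≡ suc n
  levelStart-n≡1+n = ≤-antisym (levelStart≤1+n n) (k<levelStart n ≤-refl)

  levels≡range : ∀ k → concatMap (level p n) (upTo k) ≡ range 1 (levelStart k)
  levels≡range zero    = refl
  levels≡range (suc k) = begin
    concatMap (level p n) (upTo (suc k))                       ≡⟨ cong (concatMap (level p n)) (sym (upTo-∷ʳ k)) ⟩
    concatMap (level p n) (upTo k ++ [ k ])                    ≡⟨ concatMap-++ (level p n) (upTo k) [ k ] ⟩
    concatMap (level p n) (upTo k) ++ level p n k ++ []        ≡⟨ cong₂ _++_ (levels≡range k) (trans (++-identityʳ _) (level≡range k)) ⟩
    range 1 (levelStart k) ++ range (levelStart k) (levelStart (suc k)) ≡⟨ range-++ (1≤levelStart k) (levelStart-≤-suc k) ⟩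
    range 1 (levelStart (suc k))                               ∎
    where open ≡-Reasoning

  levelOrder-sorted : levelOrder p n ≡ map suc (upTo n)
  levelOrder-sorted = begin
    levelOrder p n          ≡⟨ levels≡range n ⟩
    range 1 (levelStart n)  ≡⟨ cong (range 1) levelStart-n≡1+n ⟩
    rangeFrom 1 n           ≡⟨ sym (applyUpTo-rangeFrom suc 1 n (λ i → refl)) ⟩
    applyUpTo suc n         ≡⟨ sym (map-upTo suc n) ⟩
    map suc (upTo n)        ∎
    where open ≡-Reasoning

module IntervalParent (n : ℕ) (ℓ r s : ℕ → ℕ)
  (ℓ≤r : ∀ v → InRange n v → ℓ v ≤ r v)
  (ℓ-increasing : ∀ v w → InRange n v → InRange n w → v < w → ℓ v < ℓ w)
  (s-min : ∀ v → InRange n v → IsMinB n ℓ r v (s v)) where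

  inRange : ∀ {v} → 2 ≤ v → v ≤ n → InRange n v
  inRange 2≤v v≤n = ≤-trans (s≤s z≤n) 2≤v , v≤n

  1≤s : ∀ v → InRange n v → 1 ≤ s v
  1≤s v v∈[n] = proj₁ (proj₁ (s-min v v∈[n]))

  s≤id : ∀ v → InRange n v → s v ≤ v
  s≤id v v∈[n] = proj₂ (proj₂ (s-min v v∈[n])) v v∈[n] (≤-refl , ℓ≤r v v∈[n])

  ℓ-monotone : ∀ v w → InRange n v → InRange n w → v ≤ w → ℓ v ≤ ℓ w
  ℓ-monotone v w v∈[n] w∈[n] v≤w with m≤n⇒m<n∨m≡n v≤w
  ... | inj₁ v<w  = <⇒≤ (ℓ-increasing v w v∈[n] w∈[n] v<w)
  ... | inj₂ refl = ≤-refl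

  -- If s w < s v, the interval of s w starts before ℓ v (as s w < v) and ends after ℓ w ≥ ℓ v,
  -- so s w ∈ B_v, against the minimality of s v.
  s-monotone : ∀ v w → InRange n v → InRange n w → v ≤ w → s v ≤ s w
  s-monotone v w v∈[n] w∈[n] v≤w with s v ≤? s w
  ... | yes sv≤sw = sv≤sw
  ... | no  sv≰sw = contradiction (proj₂ (proj₂ (s-min v v∈[n])) (s w) sw∈[n] sw∈Bv) (<⇒≱ sw<sv)
    where
    sw<sv = ≰⇒> sv≰sw
    sw∈[n] = proj₁ (s-min w w∈[n])
    sw∈Bw = proj₁ (proj₂ (s-min w w∈[n]))
    sw∈Bv : InB ℓ r v (s w)
    sw∈Bv = <⇒≤ (ℓ-increasing (s w) v sw∈[n] v∈[n] (<-≤-trans sw<sv (s≤id v v∈[n])))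
          , ≤-trans (ℓ-monotone v w v∈[n] w∈[n] v≤w) (proj₂ sw∈Bw)

  parent-positive : ∀ v → 2 ≤ v → v ≤ n → 1 ≤ parent s v
  parent-positive v 2≤v v≤n with s v ≟ v
  ... | yes _ = ∸-monoˡ-≤ 1 2≤v
  ... | no  _ = 1≤s v (inRange 2≤v v≤n)

  parent-decreasing : ∀ v → 2 ≤ v → v ≤ n → parent s v < v
  parent-decreasing (suc v) 2≤v v≤n with s (suc v) ≟ suc v
  ... | yes _    = n<1+n v
  ... | no  sv≢v = ≤∧≢⇒< (s≤id (suc v) (inRange 2≤v v≤n)) sv≢v

  parent-monotone : ∀ v w → 2 ≤ v → v ≤ w → w ≤ n → parent s v ≤ parent s w
  parent-monotone v w 2≤v v≤w w≤n = by-cases (s-monotone v w v∈[n] w∈[n] v≤w) (s≤id v v∈[n])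
    where
    v∈[n] = inRange 2≤v (≤-trans v≤w w≤n)
    w∈[n] = inRange (≤-trans 2≤v v≤w) w≤n
    by-cases : s v ≤ s w → s v ≤ v → parent s v ≤ parent s w
    by-cases sv≤sw sv≤v with s v ≟ v | s w ≟ w
    ... | yes _    | yes _ = ∸-monoˡ-≤ 1 v≤w
    ... | yes sv≡v | no  _ = ≤-trans (m∸n≤m v 1) (subst (_≤ s w) sv≡v sv≤sw)
    ... | no  sv≢v | yes _ = ∸-monoˡ-≤ 1 (≤-trans (≤∧≢⇒< sv≤v sv≢v) v≤w)
    ... | no  _    | no  _ = sv≤sw

lemma7 : (n : ℕ) → 1 ≤ n → (ℓ r s : ℕ → ℕ)
    → (∀ v → InRange n v → ℓ v ≤ r v)
    → (∀ v → InRange n v → InRange (n + n) (ℓ v) × InRange (n + n) (r v))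
    → (∀ v w → InRange n v → InRange n w → ℓ v ≢ r w)
    → (∀ v w → InRange n v → InRange n w → r v ≡ r w → v ≡ w)
    → (∀ v w → InRange n v → InRange n w → v < w → ℓ v < ℓ w)
    → (∀ v → InRange n v → IsMinB n ℓ r v (s v))
    → levelOrder (parent s) n ≡ map suc (upTo n)
lemma7 n 1≤n ℓ r s ℓ≤r _ _ _ ℓ-increasing s-min =
  MonotoneParent.levelOrder-sorted n 1≤n (parent s) parent-positive parent-decreasing parent-monotone
  where open IntervalParent n ℓ r s ℓ≤r ℓ-increasing s-min
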